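{- Let $j\in\{1,\ldots,k\}$ and let $S\in\Omega_{j-1}$ be normalized. Then for all $X\in\Omega_j$ we have $X\,e\,S$ if and only if there exists $p\in u_j^{\mathrm{Aut}(U_{j-1})}$ with $\underline{X}=U_{j-1}\cup\{p\}$ and $X|_{U_{j-1}}=S$.
   Context: Let $U$, $R$ be finite sets. Permutations act on the right and $\pi_1\pi_2$ means first $\pi_1$ then $\pi_2$. The wreath product $\mathrm{Sym}(R)\wr\mathrm{Sym}(U)$ consists of pairs $(\pi,\sigma)$ with $\pi\in\mathrm{Sym}(U)$, $\sigma:U\to\mathrm{Sym}(R)$, with product $(\pi_1,\sigma_1)(\pi_2,\sigma_2)=(\pi_1\pi_2,\sigma)$, $\sigma(u)=\sigma_1(u^{\pi_2^{ -1}})\sigma_2(u)$. Let $\Gamma\le\mathrm{Sym}(R)\wr\mathrm{Sym}(U)$. $\gamma=(\pi,\sigma)$ acts on $u\in U$ by $u^\gamma=u^\pi$, on subsets of $U$ elementwise, and on partial assignments $X:W\to R$ ($W\subseteq U$) by $X^\gamma:W^\pi\to R$, $X^\gamma(u)=X(u^{\pi^{ -1}})^{\sigma(u)}$. Write $\underline{X}=W$, and $X|_Q$ for restriction. For an object $Y$ acted on by $\Gamma$, $\mathrm{Aut}(Y)=\{\gamma\in\Gamma:Y^\gamma=Y\}$, and $Y^\Lambda=\{Y^\lambda:\lambda\in\Lambda\}$. Fix distinct $u_1,\ldots,u_k\in U$, $U_j=\{u_1,\ldots,u_j\}$ ($U_0=\emptyset$). $\Omega_j$ is the set of partial assignments $X$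 with $\underline{X}=U_j^\gamma$ for some $\gamma\in\Gamma$; $X\in\Omega_j$ is normalized if $\underline{X}=U_j$. For $X\in\Omega_j$, $S\in\Omega_{j-1}$, $X\,e\,S$ iff there exists $\gamma\in\Gamma$ with $\underline{X}^\gamma=U_j$, $\underline{S}^\gamma=U_{j-1}$, and $X^\gamma|_{U_{j-1}}=S^\gamma$. -}

module Defs where

open import Data.Nat using (ℕ; suc; _<?_)
open import Data.Fin using (Fin; toℕ; _≟_)
open import Data.Fin.Properties using (any?)
open import Data.Fin.Subset using (Subset; _∪_; ⁅_⁆)
open import Data.Fin.Permutation using (Permutation′; _⟨$⟩ʳ_; _⟨$⟩ˡ_; _∘ₚ_; flip)
import Data.Fin.Permutation as P
open import Data.Vec using (tabulate; lookup)
open import Data.Maybe using (Maybe; just; nothing; is-just)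
import Data.Maybe as M
open import Data.Bool using (Bool; if_then_else_)
open import Data.Product using (Σ; _×_; _,_)
open import Relation.Nullary using (does)
open import Relation.Nullary.Decidable using (_×-dec_)
open import Relation.Binary.PropositionalEquality using (_≡_)
open import Function.Definitions using (Injective)

-- U = Fin n, R = Fin m.  Permutations act on the right: u^π = π ⟨$⟩ʳ u,
-- and π₁ ∘ₚ π₂ means "first π₁, then π₂".

-- Elements (π , σ) of Sym(R) ≀ Sym(U).
record Wr (n m : ℕ) : Set where
  constructor ⟨_,_⟩
  field
    π : Permutation′ n
    σ : Fin n → Permutation′ m
open Wr public

_·_ : ∀ {n m} → Wr n m → Wr n m → Wr n m
⟨ π₁ , σ₁ ⟩ · ⟨ π₂ , σ₂ ⟩ = ⟨ π₁ ∘ₚ π₂ , (λ u → σ₁ (π₂ ⟨$⟩ˡ u) ∘ₚ σ₂ u) ⟩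

e₁ : ∀ {n m} → Wr n m
e₁ = ⟨ P.id , (λ _ → P.id) ⟩

_⁻¹ : ∀ {n m} → Wr n m → Wr n m
⟨ π , σ ⟩ ⁻¹ = ⟨ flip π , (λ u → flip (σ (π ⟨$⟩ʳ u))) ⟩

_≈W_ : ∀ {n m} → Wr n m → Wr n m → Set
γ ≈W δ = (∀ u → π γ ⟨$⟩ʳ u ≡ π δ ⟨$⟩ʳ u)
       × (∀ u r → σ γ u ⟨$⟩ʳ r ≡ σ δ u ⟨$⟩ʳ r)

record IsSubgroup {n m : ℕ} (Γ : Wr n m → Set) : Set where
  field
    ∈-resp : ∀ {γ δ} → γ ≈W δ → Γ γ → Γ δ
    ∈-id   : Γ e₁
    ∈-mul  : ∀ {γ δ} → Γ γ → Γ δ → Γ (γ · δ)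
    ∈-inv  : ∀ {γ} → Γ γ → Γ (γ ⁻¹)

_^ᵘ_ : ∀ {n m} → Fin n → Wr n m → Fin n
u ^ᵘ γ = π γ ⟨$⟩ʳ u

_^ˢ_ : ∀ {n m} → Subset n → Wr n m → Subset n
W ^ˢ γ = tabulate (λ v → lookup W (π γ ⟨$⟩ˡ v))

-- partial assignments X : W → R, W ⊆ U, as maps U → Maybe R
PAssign : ℕ → ℕ → Set
PAssign n m = Fin n → Maybe (Fin m)

dom : ∀ {n m} → PAssign n m → Subset n
dom X = tabulate (λ u → is-just (X u))

_^ᵃ_ : ∀ {n m} → PAssign n m → Wr n m → PAssign n m
(X ^ᵃ γ) v = M.map (λ r → σ γ v ⟨$⟩ʳ r) (X (π γ ⟨$⟩ˡ v))

_∣_ : ∀ {n m} → PAssign n m → Subset n → PAssign n m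
(X ∣ Q) v = if lookup Q v then X v else nothing

_≐_ : ∀ {n m} → PAssign n m → PAssign n m → Set
X ≐ Y = ∀ v → X v ≡ Y v

module Setup {n m k : ℕ} (Γ : Wr n m → Set) (u : Fin k → Fin n) where

  -- U_j = {u_1,…,u_j}  (with u_{i+1} = u i for i : Fin k)
  Uset : ℕ → Subset n
  Uset j = tabulate (λ v → does (any? (λ i → (toℕ i <? j) ×-dec (u i ≟ v))))

  Ω : ℕ → PAssign n m → Set
  Ω j X = Σ (Wr n m) (λ γ → Γ γ × (dom X ≡ Uset j ^ˢ γ))

  Normalized : ℕ → PAssign n m → Set
  Normalized j X = dom X ≡ Uset j

  -- X e S  (X ∈ Ω_j, S ∈ Ω_{j-1}); j is passed explicitly
  Edge : ℕ → PAssign n m → PAssign n m → Set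
  Edge j X S = Σ (Wr n m) (λ γ → Γ γ × (dom X ^ˢ γ ≡ Uset (suc j)) ×
                 (dom S ^ˢ γ ≡ Uset j) × (((X ^ᵃ γ) ∣ Uset j) ≐ (S ^ᵃ γ)))

  Aut : Subset n → Wr n m → Set
  Aut W γ = Γ γ × (W ^ˢ γ ≡ W)

  InOrbit : Fin n → (Wr n m → Set) → Fin n → Set
  InOrbit q Λ p = Σ (Wr n m) (λ γ → Λ γ × (p ≡ q ^ᵘ γ))

module Submission where

-- Let U = U_{j-1} and let S be normalized, so dom S = U.
-- A witness γ of X e S then satisfies U^γ = U, i.e. γ ∈ Aut(U), and the two
-- remaining conditions of X e S can be pulled back along γ:
--   * dom X ^ γ = U ∪ {u_j}  ⇔  dom X = U ∪ {u_j^{γ⁻¹}}        (domain-transport)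
--   * (X^γ)|_U = S^γ        ⇔  X|_U = S                        (restriction-transport)
-- Forward, p = u_j^{γ⁻¹} lies in the Aut(U)-orbit of u_j via γ⁻¹; backward, a
-- witness δ ∈ Aut(U) of p = u_j^δ yields the edge witness γ = δ⁻¹.

open import Defs
open import Data.Nat using (ℕ; suc; _<_; s≤s; _<?_)
open import Data.Nat.Properties using (≤-refl; <⇒≤; ≤-pred; m≤n⇒m<n∨m≡n)
open import Data.Fin using (Fin; toℕ; _≟_; zero; suc)
open import Data.Fin.Properties using (any?; toℕ-injective)
open import Data.Fin.Subset using (Subset; _∪_; ⁅_⁆)
open import Data.Fin.Permutation using (_⟨$⟩ʳ_; _⟨$⟩ˡ_; inverseˡ; inverseʳ)
open import Data.Vec using (lookup)
open import Data.Vec.Properties using (tabulate∘lookup; tabulate-cong; lookup∘tabulate; lookup-zipWith; lookup-replicate)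
import Data.Maybe as M
open import Data.Maybe.Properties using (map-∘; map-cong; map-id)
open import Data.Bool using (true; false; _∨_)
open import Data.Product using (Σ; _×_; _,_)
open import Data.Sum using (_⊎_; inj₁; inj₂)
open import Relation.Nullary using (does)
open import Relation.Nullary.Decidable using (does-⇔; _×-dec_; _⊎-dec_)
open import Relation.Binary.PropositionalEquality
open import Function.Definitions using (Injective)
open import Function.Bundles using (_⇔_; mk⇔; Equivalence)

subset-ext : ∀ {n} {A B : Subset n} → (∀ v → lookup A v ≡ lookup B v) → A ≡ B
subset-ext {A = A} {B} A≗B =
  trans (sym (tabulate∘lookup A)) (trans (tabulate-cong A≗B) (tabulate∘lookup B))

lookup-∪ : ∀ {n} (A B : Subset n) v → lookup (A ∪ B) v ≡ lookup A v ∨ lookup B v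
lookup-∪ A B v = lookup-zipWith _∨_ v A B

lookup-⁅⁆ : ∀ {n} (p v : Fin n) → lookup ⁅ p ⁆ v ≡ does (p ≟ v)
lookup-⁅⁆ zero    zero    = refl
lookup-⁅⁆ zero    (suc v) = lookup-replicate v false
lookup-⁅⁆ (suc p) zero    = refl
lookup-⁅⁆ (suc p) (suc v) with p ≟ v | lookup-⁅⁆ p v
... | _ | p∈⁅v⁆ = p∈⁅v⁆

module _ {n m : ℕ} where

  lookup-^ˢ : (W : Subset n) (γ : Wr n m) (v : Fin n) →
              lookup (W ^ˢ γ) v ≡ lookup W (π γ ⟨$⟩ˡ v)
  lookup-^ˢ W γ v = lookup∘tabulate _ v

  ^ˢ-⁻¹ : (W : Subset n) (γ : Wr n m) → (W ^ˢ γ) ^ˢ (γ ⁻¹) ≡ W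
  ^ˢ-⁻¹ W γ = subset-ext λ v → begin
    lookup ((W ^ˢ γ) ^ˢ (γ ⁻¹)) v    ≡⟨ lookup-^ˢ (W ^ˢ γ) (γ ⁻¹) v ⟩
    lookup (W ^ˢ γ) (π γ ⟨$⟩ʳ v)     ≡⟨ lookup-^ˢ W γ (π γ ⟨$⟩ʳ v) ⟩
    lookup W (π γ ⟨$⟩ˡ (π γ ⟨$⟩ʳ v)) ≡⟨ cong (lookup W) (inverseˡ (π γ)) ⟩
    lookup W v                       ∎
    where open ≡-Reasoning

  ^ᵃ-⁻¹ : (X : PAssign n m) (γ : Wr n m) → ((X ^ᵃ γ) ^ᵃ (γ ⁻¹)) ≐ X
  ^ᵃ-⁻¹ X γ v = begin
    M.map (σ′ ⟨$⟩ˡ_) (M.map (σ′ ⟨$⟩ʳ_) (X (π γ ⟨$⟩ˡ w))) ≡⟨ map-∘ (X (π γ ⟨$⟩ˡ w)) ⟨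
    M.map (λ r → σ′ ⟨$⟩ˡ (σ′ ⟨$⟩ʳ r)) (X (π γ ⟨$⟩ˡ w))   ≡⟨ cong (M.map _) (cong X (inverseˡ (π γ))) ⟩
    M.map (λ r → σ′ ⟨$⟩ˡ (σ′ ⟨$⟩ʳ r)) (X v)              ≡⟨ map-cong (λ _ → inverseˡ σ′) (X v) ⟩
    M.map (λ r → r) (X v)                               ≡⟨ map-id (X v) ⟩
    X v                                                 ∎
    where
    open ≡-Reasoning
    w = π γ ⟨$⟩ʳ v
    σ′ = σ γ w

  ^ᵃ-injective : {X Y : PAssign n m} (γ : Wr n m) → (X ^ᵃ γ) ≐ (Y ^ᵃ γ) → X ≐ Y
  ^ᵃ-injective {X} {Y} γ Xγ≐Yγ v =
    trans (sym (^ᵃ-⁻¹ X γ v))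
      (trans (cong (M.map _) (Xγ≐Yγ (π γ ⟨$⟩ʳ v))) (^ᵃ-⁻¹ Y γ v))

  ^ˢ-∪ : (A B : Subset n) (γ : Wr n m) → (A ∪ B) ^ˢ γ ≡ (A ^ˢ γ) ∪ (B ^ˢ γ)
  ^ˢ-∪ A B γ = subset-ext λ v → begin
    lookup ((A ∪ B) ^ˢ γ) v                             ≡⟨ lookup-^ˢ (A ∪ B) γ v ⟩
    lookup (A ∪ B) (π γ ⟨$⟩ˡ v)                         ≡⟨ lookup-∪ A B _ ⟩
    lookup A (π γ ⟨$⟩ˡ v) ∨ lookup B (π γ ⟨$⟩ˡ v)       ≡⟨ cong₂ _∨_ (lookup-^ˢ A γ v) (lookup-^ˢ B γ v) ⟨
    lookup (A ^ˢ γ) v ∨ lookup (B ^ˢ γ) v               ≡⟨ lookup-∪ (A ^ˢ γ) (B ^ˢ γ) v ⟨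
    lookup ((A ^ˢ γ) ∪ (B ^ˢ γ)) v                      ∎
    where open ≡-Reasoning

  ^ˢ-⁅⁆ : (p : Fin n) (γ : Wr n m) → ⁅ p ⁆ ^ˢ γ ≡ ⁅ p ^ᵘ γ ⁆
  ^ˢ-⁅⁆ p γ = subset-ext λ v → begin
    lookup (⁅ p ⁆ ^ˢ γ) v          ≡⟨ lookup-^ˢ ⁅ p ⁆ γ v ⟩
    lookup ⁅ p ⁆ (π γ ⟨$⟩ˡ v)      ≡⟨ lookup-⁅⁆ p _ ⟩
    does (p ≟ (π γ ⟨$⟩ˡ v))        ≡⟨ does-⇔ (moved⇔ v) (p ≟ _) ((p ^ᵘ γ) ≟ v) ⟩
    does ((p ^ᵘ γ) ≟ v)            ≡⟨ lookup-⁅⁆ (p ^ᵘ γ) v ⟨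
    lookup ⁅ p ^ᵘ γ ⁆ v            ∎
    where
    open ≡-Reasoning
    moved⇔ : ∀ v → (p ≡ π γ ⟨$⟩ˡ v) ⇔ (p ^ᵘ γ ≡ v)
    moved⇔ v = mk⇔ (λ { refl → inverseʳ (π γ) }) (λ { refl → sym (inverseˡ (π γ)) })

  ^ˢ-stable-∪⁅⁆ : {W : Subset n} (γ : Wr n m) (q : Fin n) →
                  W ^ˢ γ ≡ W → (W ∪ ⁅ q ⁆) ^ˢ γ ≡ W ∪ ⁅ q ^ᵘ γ ⁆
  ^ˢ-stable-∪⁅⁆ {W} γ q Wγ≡W =
    trans (^ˢ-∪ W ⁅ q ⁆ γ) (cong₂ _∪_ Wγ≡W (^ˢ-⁅⁆ q γ))

  stable-⁻¹ : {W : Subset n} (γ : Wr n m) → W ^ˢ γ ≡ W → W ^ˢ (γ ⁻¹) ≡ W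
  stable-⁻¹ {W} γ Wγ≡W = trans (cong (_^ˢ (γ ⁻¹)) (sym Wγ≡W)) (^ˢ-⁻¹ W γ)

  ^ᵃ-∣ : (X : PAssign n m) (W : Subset n) (γ : Wr n m) →
         ((X ∣ W) ^ᵃ γ) ≐ ((X ^ᵃ γ) ∣ (W ^ˢ γ))
  ^ᵃ-∣ X W γ v rewrite lookup-^ˢ W γ v with lookup W (π γ ⟨$⟩ˡ v)
  ... | true  = refl
  ... | false = refl

  domain-transport : {W D : Subset n} (γ : Wr n m) (q : Fin n) → W ^ˢ γ ≡ W →
                     (D ^ˢ γ ≡ W ∪ ⁅ q ⁆) ⇔ (D ≡ W ∪ ⁅ q ^ᵘ (γ ⁻¹) ⁆)
  domain-transport {W} {D} γ q Wγ≡W = mk⇔ pull push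
    where
    pull : D ^ˢ γ ≡ W ∪ ⁅ q ⁆ → D ≡ W ∪ ⁅ q ^ᵘ (γ ⁻¹) ⁆
    pull Dγ≡ = begin
      D                          ≡⟨ ^ˢ-⁻¹ D γ ⟨
      (D ^ˢ γ) ^ˢ (γ ⁻¹)         ≡⟨ cong (_^ˢ (γ ⁻¹)) Dγ≡ ⟩
      (W ∪ ⁅ q ⁆) ^ˢ (γ ⁻¹)      ≡⟨ ^ˢ-stable-∪⁅⁆ (γ ⁻¹) q (stable-⁻¹ γ Wγ≡W) ⟩
      W ∪ ⁅ q ^ᵘ (γ ⁻¹) ⁆        ∎
      where open ≡-Reasoning
    push : D ≡ W ∪ ⁅ q ^ᵘ (γ ⁻¹) ⁆ → D ^ˢ γ ≡ W ∪ ⁅ q ⁆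
    push refl = begin
      (W ∪ ⁅ q ^ᵘ (γ ⁻¹) ⁆) ^ˢ γ ≡⟨ ^ˢ-stable-∪⁅⁆ γ (q ^ᵘ (γ ⁻¹)) Wγ≡W ⟩
      W ∪ ⁅ (q ^ᵘ (γ ⁻¹)) ^ᵘ γ ⁆ ≡⟨ cong (λ r → W ∪ ⁅ r ⁆) (inverseʳ (π γ)) ⟩
      W ∪ ⁅ q ⁆                  ∎
      where open ≡-Reasoning

  restriction-transport : {W : Subset n} (γ : Wr n m) (X S : PAssign n m) → W ^ˢ γ ≡ W →
                          ((X ^ᵃ γ) ∣ W) ≐ (S ^ᵃ γ) ⇔ (X ∣ W) ≐ S
  restriction-transport {W} γ X S Wγ≡W = mk⇔ pull push
    where
    -- (X|_W)^γ = (X^γ)|_{W^γ} = (X^γ)|_W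
    commute : ((X ∣ W) ^ᵃ γ) ≐ ((X ^ᵃ γ) ∣ W)
    commute v = trans (^ᵃ-∣ X W γ v) (cong (λ V → ((X ^ᵃ γ) ∣ V) v) Wγ≡W)
    pull : ((X ^ᵃ γ) ∣ W) ≐ (S ^ᵃ γ) → (X ∣ W) ≐ S
    pull eq = ^ᵃ-injective γ λ v → trans (commute v) (eq v)
    push : (X ∣ W) ≐ S → ((X ^ᵃ γ) ∣ W) ≐ (S ^ᵃ γ)
    push eq v = trans (sym (commute v)) (cong (M.map _) (eq (π γ ⟨$⟩ˡ v)))

module _ {n m k : ℕ} (Γ : Wr n m → Set) (u : Fin k → Fin n) where
  open Setup Γ u

  -- U_j = U_{j-1} ∪ {u_j}, where j = 1 + toℕ i and u_j = u i.
  Uset-suc : (i : Fin k) → Uset (suc (toℕ i)) ≡ Uset (toℕ i) ∪ ⁅ u i ⁆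
  Uset-suc i = subset-ext λ v → begin
    lookup (Uset (suc j)) v                        ≡⟨ lookup∘tabulate _ v ⟩
    does (any? (λ i′ → (toℕ i′ <? suc j) ×-dec (u i′ ≟ v)))
      ≡⟨ does-⇔ (mk⇔ split join) (any? (λ i′ → (toℕ i′ <? suc j) ×-dec (u i′ ≟ v)))
                                    (any? (λ i′ → (toℕ i′ <? j) ×-dec (u i′ ≟ v)) ⊎-dec (u i ≟ v)) ⟩
    does (any? (λ i′ → (toℕ i′ <? j) ×-dec (u i′ ≟ v))) ∨ does (u i ≟ v)
      ≡⟨ cong₂ _∨_ (lookup∘tabulate _ v) (lookup-⁅⁆ (u i) v) ⟨
    lookup (Uset j) v ∨ lookup ⁅ u i ⁆ v           ≡⟨ lookup-∪ (Uset j) ⁅ u i ⁆ v ⟨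
    lookup (Uset j ∪ ⁅ u i ⁆) v                    ∎
    where
    open ≡-Reasoning
    j = toℕ i
    split : ∀ {v} → (Σ (Fin k) λ i′ → toℕ i′ < suc j × u i′ ≡ v) →
            (Σ (Fin k) λ i′ → toℕ i′ < j × u i′ ≡ v) ⊎ u i ≡ v
    split (i′ , i′<1+j , ui′≡v) with m≤n⇒m<n∨m≡n (≤-pred i′<1+j)
    ... | inj₁ i′<j = inj₁ (i′ , i′<j , ui′≡v)
    ... | inj₂ i′≡j = inj₂ (trans (cong u (sym (toℕ-injective i′≡j))) ui′≡v)
    join : ∀ {v} → (Σ (Fin k) λ i′ → toℕ i′ < j × u i′ ≡ v) ⊎ u i ≡ v →
           (Σ (Fin k) λ i′ → toℕ i′ < suc j × u i′ ≡ v)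
    join (inj₁ (i′ , i′<j , ui′≡v)) = i′ , s≤s (<⇒≤ i′<j) , ui′≡v
    join (inj₂ ui≡v)                = i , ≤-refl , ui≡v

lemma5p3 : ∀ {n m k} (Γ : Wr n m → Set) → IsSubgroup Γ →
    (u : Fin k → Fin n) → Injective _≡_ _≡_ u →
    (i : Fin k) (S : PAssign n m) →
    Setup.Ω Γ u (toℕ i) S → Setup.Normalized Γ u (toℕ i) S →
    (X : PAssign n m) → Setup.Ω Γ u (suc (toℕ i)) X →
    Setup.Edge Γ u (toℕ i) X S ⇔
      Σ (Fin n) (λ p →
        Setup.InOrbit Γ u (u i) (Setup.Aut Γ u (Setup.Uset Γ u (toℕ i))) p ×
        (dom X ≡ Setup.Uset Γ u (toℕ i) ∪ ⁅ p ⁆) ×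
        ((X ∣ Setup.Uset Γ u (toℕ i)) ≐ S))
lemma5p3 {n} Γ G u _ i S _ domS≡U X _ = mk⇔ forward backward
  where
  open Setup Γ u
  open IsSubgroup G
  open Equivalence
  U = Uset (toℕ i)

  -- An edge witness γ stabilises U = dom S; p = u_j^{γ⁻¹} is reached by γ⁻¹ ∈ Aut(U).
  forward : Edge (toℕ i) X S →
            Σ (Fin n) λ p → InOrbit (u i) (Aut U) p × (dom X ≡ U ∪ ⁅ p ⁆) × ((X ∣ U) ≐ S)
  forward (γ , γ∈Γ , domXγ , domSγ , restricts) =
    u i ^ᵘ (γ ⁻¹) , (γ ⁻¹ , (∈-inv γ∈Γ , stable-⁻¹ γ Uγ≡U) , refl) ,
    to (domain-transport γ (u i) Uγ≡U) (trans domXγ (Uset-suc Γ u i)) ,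
    to (restriction-transport γ X S Uγ≡U) restricts
    where
    Uγ≡U : U ^ˢ γ ≡ U
    Uγ≡U = subst (λ W → W ^ˢ γ ≡ U) domS≡U domSγ

  backward : (Σ (Fin n) λ p → InOrbit (u i) (Aut U) p × (dom X ≡ U ∪ ⁅ p ⁆) × ((X ∣ U) ≐ S)) →
             Edge (toℕ i) X S
  backward (_ , (δ , (δ∈Γ , Uδ≡U) , refl) , domX≡ , restricts) =
    δ ⁻¹ , ∈-inv δ∈Γ ,
    trans (from (domain-transport (δ ⁻¹) (u i) Uδ⁻¹≡U) domX≡) (sym (Uset-suc Γ u i)) ,
    subst (λ W → W ^ˢ (δ ⁻¹) ≡ U) (sym domS≡U) Uδ⁻¹≡U ,
    from (restriction-transport (δ ⁻¹) X S Uδ⁻¹≡U) restricts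
    where
    Uδ⁻¹≡U : U ^ˢ (δ ⁻¹) ≡ U
    Uδ⁻¹≡U = stable-⁻¹ δ Uδ≡U
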